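{- Let $D$ be an orientation of $K_{m,n}$ and let $u,v$ be adjacent vertices in $C_{1,2}(D)$. Then $u$ and $v$ belong to distinct partite sets of $K_{m,n}$ if and only if $u$ and $v$ $(1,2)$-compete in $D$.
   Context: Vertices $u,v$ of a digraph $D$ $(1,2)$-compete if there is a vertex $w\neq u,v$ such that either there is an arc $(u,w)$ and a directed $(v,w)$-walk of length $2$ not traversing $u$, or there is a directed $(u,w)$-walk of length $2$ not traversing $v$ and an arc $(v,w)$. For vertices $x,y$ of a digraph $H$, $d_H(x,y)$ is the length of a shortest directed $(x,y)$-path. The $(1,2)$-step competition graph $C_{1,2}(D)$ is the simple graph on $V(D)$ in which distinct $u,v$ are adjacent iff there is $w\neq u,v$ with either $d_{D-v}(u,w)\le 1$ and $d_{D-u}(v,w)\le 2$, or $d_{D-u}(v,w)\le 1$ and $d_{D-v}(u,w)\le 2$. -}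

module Defs where

open import Data.Nat using (ℕ)
open import Data.Fin using (Fin)
open import Data.Bool using (Bool; true; false)
open import Data.Sum using (_⊎_; inj₁; inj₂)
open import Data.Product using (Σ; ∃; _×_; _,_)
open import Data.Empty using (⊥)
open import Data.Unit using (⊤)
open import Relation.Binary.PropositionalEquality using (_≡_; _≢_)

Vtx : ℕ → ℕ → Set
Vtx m n = Fin m ⊎ Fin n

-- An orientation of K_{m,n}: for each left x and right y, o x y = true
-- means the arc (x , y), and o x y = false means the arc (y , x).
Orientation : ℕ → ℕ → Set
Orientation m n = Fin m → Fin n → Bool

Arc : ∀ {m n} → Orientation m n → Vtx m n → Vtx m n → Set
Arc o (inj₁ x) (inj₁ x') = ⊥
Arc o (inj₂ y) (inj₂ y') = ⊥
Arc o (inj₁ x) (inj₂ y) = o x y ≡ true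
Arc o (inj₂ y) (inj₁ x) = o x y ≡ false

SamePart : ∀ {m n} → Vtx m n → Vtx m n → Set
SamePart (inj₁ _) (inj₁ _) = ⊤
SamePart (inj₂ _) (inj₂ _) = ⊤
SamePart (inj₁ _) (inj₂ _) = ⊥
SamePart (inj₂ _) (inj₁ _) = ⊥

DistinctParts : ∀ {m n} → Vtx m n → Vtx m n → Set
DistinctParts u v = SamePart u v → ⊥

-- A directed (a,b)-walk of length 2 in D not traversing z:
-- a → c → b with c ≠ z (a, b ≠ z are imposed separately where needed).
Walk2Avoiding : ∀ {m n} → Orientation m n → Vtx m n → Vtx m n → Vtx m n → Set
Walk2Avoiding o z a b = Σ _ λ c → c ≢ z × Arc o a c × Arc o c b

Compete12 : ∀ {m n} → Orientation m n → Vtx m n → Vtx m n → Set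
Compete12 o u v = Σ _ λ w → w ≢ u × w ≢ v ×
  ((Arc o u w × Walk2Avoiding o u v w) ⊎ (Walk2Avoiding o v u w × Arc o v w))

Dist≤1Avoiding : ∀ {m n} → Orientation m n → Vtx m n → Vtx m n → Vtx m n → Set
Dist≤1Avoiding o z a b = (a ≡ b) ⊎ Arc o a b

Dist≤2Avoiding : ∀ {m n} → Orientation m n → Vtx m n → Vtx m n → Vtx m n → Set
Dist≤2Avoiding o z a b = (a ≡ b) ⊎ Arc o a b ⊎ Walk2Avoiding o z a b

-- Adjacency in the (1,2)-step competition graph C_{1,2}(D)
Adj12 : ∀ {m n} → Orientation m n → Vtx m n → Vtx m n → Set
Adj12 o u v = u ≢ v × (Σ _ λ w → w ≢ u × w ≢ v ×
  ((Dist≤1Avoiding o v u w × Dist≤2Avoiding o u v w)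
   ⊎ (Dist≤1Avoiding o u v w × Dist≤2Avoiding o v u w)))

module Submission where

open import Data.Nat using (ℕ)
open import Data.Sum using (inj₁; inj₂)
open import Data.Product using (_,_)
open import Data.Empty using (⊥-elim)
open import Data.Unit using (tt)
open import Function.Bundles using (_⇔_; mk⇔)
open import Relation.Nullary using (¬_)
open import Relation.Binary.PropositionalEquality using (_≢_; sym)

open import Defs

-- Every arc of an orientation of K_{m,n} crosses between the partite sets, so a
-- 2-walk returns to its starting side and two in-neighbours of a vertex lie on one
-- side.  Hence (1,2)-competitors lie on different sides; conversely, for vertices on
-- different sides the degenerate alternatives in the definition of adjacency in
-- C_{1,2}(D) (equal endpoints, two arcs into w) are excluded, leaving a competition.

module _ {m n : ℕ} where

  SamePart-sym : {a b : Vtx m n} → SamePart a b → SamePart b a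
  SamePart-sym {inj₁ _} {inj₁ _} _ = tt
  SamePart-sym {inj₂ _} {inj₂ _} _ = tt

  SamePart-trans : {a b c : Vtx m n} → SamePart a b → SamePart b c → SamePart a c
  SamePart-trans {inj₁ _} {inj₁ _} {inj₁ _} _ _ = tt
  SamePart-trans {inj₂ _} {inj₂ _} {inj₂ _} _ _ = tt

  module _ (o : Orientation m n) where

    Arc⇒DistinctParts : {a b : Vtx m n} → Arc o a b → DistinctParts a b
    Arc⇒DistinctParts {inj₁ _} {inj₂ _} _ ()
    Arc⇒DistinctParts {inj₂ _} {inj₁ _} _ ()

    Arc²⇒SamePart : {a c b : Vtx m n} → Arc o a c → Arc o c b → SamePart a b
    Arc²⇒SamePart {inj₁ _} {inj₂ _} {inj₁ _} _ _ = tt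
    Arc²⇒SamePart {inj₂ _} {inj₁ _} {inj₂ _} _ _ = tt

    commonOutNeighbour⇒SamePart : {a b w : Vtx m n} →
      Arc o a w → Arc o b w → SamePart a b
    commonOutNeighbour⇒SamePart {inj₁ _} {inj₁ _} {inj₂ _} _ _ = tt
    commonOutNeighbour⇒SamePart {inj₂ _} {inj₂ _} {inj₁ _} _ _ = tt

    Walk2Avoiding⇒SamePart : {z a b : Vtx m n} → Walk2Avoiding o z a b → SamePart a b
    Walk2Avoiding⇒SamePart (_ , _ , ac , cb) = Arc²⇒SamePart ac cb

    -- Dist≤1Avoiding does not mention its avoided vertex z, so callers must supply it.
    Dist≤1Avoiding⇒Arc : {z a b : Vtx m n} → a ≢ b →
      Dist≤1Avoiding o z a b → Arc o a b
    Dist≤1Avoiding⇒Arc a≢b (inj₁ a≡b) = ⊥-elim (a≢b a≡b)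
    Dist≤1Avoiding⇒Arc _   (inj₂ ab)  = ab

    Dist≤2Avoiding⇒Walk2Avoiding : {z a b : Vtx m n} → a ≢ b → ¬ Arc o a b →
      Dist≤2Avoiding o z a b → Walk2Avoiding o z a b
    Dist≤2Avoiding⇒Walk2Avoiding a≢b _   (inj₁ a≡b)        = ⊥-elim (a≢b a≡b)
    Dist≤2Avoiding⇒Walk2Avoiding _   ¬ab (inj₂ (inj₁ ab))  = ⊥-elim (¬ab ab)
    Dist≤2Avoiding⇒Walk2Avoiding _   _   (inj₂ (inj₂ acb)) = acb

    Compete12⇒DistinctParts : {u v : Vtx m n} → Compete12 o u v → DistinctParts u v
    Compete12⇒DistinctParts (w , _ , _ , inj₁ (uw , vw²)) uv =
      Arc⇒DistinctParts uw (SamePart-trans uv (Walk2Avoiding⇒SamePart vw²))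
    Compete12⇒DistinctParts (w , _ , _ , inj₂ (uw² , vw)) uv =
      Arc⇒DistinctParts vw (SamePart-trans (SamePart-sym uv) (Walk2Avoiding⇒SamePart uw²))

    Adj12⇒DistinctParts⇒Compete12 : {u v : Vtx m n} →
      Adj12 o u v → DistinctParts u v → Compete12 o u v
    Adj12⇒DistinctParts⇒Compete12 {u} {v} (_ , w , w≢u , w≢v , inj₁ (uw≤1 , vw≤2)) uv =
      w , w≢u , w≢v , inj₁ (uw , vw²)
      where
      uw : Arc o u w
      uw = Dist≤1Avoiding⇒Arc {z = v} (λ u≡w → w≢u (sym u≡w)) uw≤1
      vw² : Walk2Avoiding o u v w
      vw² = Dist≤2Avoiding⇒Walk2Avoiding (λ v≡w → w≢v (sym v≡w))
              (λ vw → uv (commonOutNeighbour⇒SamePart uw vw)) vw≤2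
    Adj12⇒DistinctParts⇒Compete12 {u} {v} (_ , w , w≢u , w≢v , inj₂ (vw≤1 , uw≤2)) uv =
      w , w≢u , w≢v , inj₂ (uw² , vw)
      where
      vw : Arc o v w
      vw = Dist≤1Avoiding⇒Arc {z = u} (λ v≡w → w≢v (sym v≡w)) vw≤1
      uw² : Walk2Avoiding o v u w
      uw² = Dist≤2Avoiding⇒Walk2Avoiding (λ u≡w → w≢u (sym u≡w))
              (λ uw → uv (commonOutNeighbour⇒SamePart uw vw)) uw≤2

corollary2p3 : (m n : ℕ) (o : Orientation m n) (u v : Vtx m n) →
    Adj12 o u v → (DistinctParts u v ⇔ Compete12 o u v)
corollary2p3 m n o u v adj =
  mk⇔ (Adj12⇒DistinctParts⇒Compete12 o adj) (Compete12⇒DistinctParts o)
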